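{- Let $p > 5$ be a prime such that the residues of $2!, 3!, \dots, (p-1)!$ modulo $p$ are pairwise distinct. Then $$(!p - 2)^2 \equiv -1 \pmod p,$$ where $!p = 0! + 1! + \cdots + (p-1)!$.
   Context: For a positive integer $n$, Kurepa's left factorial is $!n = 0! + 1! + \cdots + (n-1)!$. -}

module Defs where

open import Data.Nat using (ℕ; zero; suc; _+_; _!)

leftFactorial : ℕ → ℕ
leftFactorial zero    = 0
leftFactorial (suc n) = leftFactorial n + n !

{-# OPTIONS --safe #-}
-- The residues of 2!, …, (p−1)! are p − 2 distinct non-zero residues, so they miss exactly one
-- non-zero residue x. As 1 + ⋯ + (p−1) ≡ 0, comparing sums gives !p − 2 ≡ −x, and comparing
-- products gives x · ∏_{k<p} k! ≡ (p−1)!. Pairing every unit with its inverse gives (p−1)!² ≡ 1.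
-- Since (k+1)!(p−2−k)! + k!(p−1−k)! = k!(p−2−k)! · p, the products k!(p−1−k)! alternate in sign,
-- so all of them are ≡ ±(p−1)! and (∏_{k<p} k!)² ≡ ±1. If it were +1, then x² ≡ (p−1)!², so
-- x ≡ (p−1)! or x ≡ −(p−1)! ≡ (p−2)!, which are both attained residues; hence x² ≡ −1.
module Submission where

open import Data.Empty using (⊥)
open import Data.Integer as ℤ using (ℤ; +_; -_; _-_; _+_; _*_)
open import Data.Integer.Divisibility using (_∣_)
import Data.Integer.Divisibility.Signed as Signed
open Signed using (∣m∣n⇒∣m+n; ∣m⇒∣-m; ∣n⇒∣m*n; ∣m⇒∣m*n; ∣⇒∣ᵤ; ∣ᵤ⇒∣)
open import Data.Integer.DivMod using (_%ℕ_; a≡a%ℕn+[a/ℕn]*n; n%ℕd<d)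
import Data.Integer.Properties as ℤ
open import Data.Integer.Tactic.RingSolver using (solve-∀)
open import Data.List using (List; []; _∷_; _++_; [_]; map; filter; length; applyDownFrom; downFrom)
open import Data.List.Membership.Propositional using (_∈_; _∉_)
open import Data.List.Membership.Propositional.Properties
  using (∈-filter⁺; ∈-filter⁻; ∈-++⁺ˡ; ∈-++⁺ʳ; ∈-++⁻; ∈-map⁺; ∈-map⁻;
         ∈-applyDownFrom⁺; ∈-applyDownFrom⁻; ∈-downFrom⁺; ∈-downFrom⁻)
open import Data.List.Membership.Propositional.Properties.WithK using (unique∧set⇒bag)
open import Data.List.Properties
  using (length-++; length-map; length-applyDownFrom; ++-identityʳ; map-id; map-∘; map-downFrom; map-applyDownFrom)
open import Data.List.Relation.Binary.BagAndSetEquality using (∼bag⇒↭)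
open import Data.List.Relation.Binary.Permutation.Propositional using (_↭_)
open import Data.List.Relation.Binary.Permutation.Propositional.Properties using (↭-length; map⁺; ∈-resp-↭)
open import Data.List.Relation.Binary.Subset.Propositional using (_⊆_)
open import Data.List.Relation.Unary.All as All using ([]; _∷_)
open import Data.List.Relation.Unary.All.Properties using (all-filter) renaming (map⁺ to All-map⁺)
open import Data.List.Relation.Unary.AllPairs using ([]; _∷_)
open import Data.List.Relation.Unary.Any using (here; there)
open import Data.List.Relation.Unary.Unique.Propositional using (Unique)
open import Data.List.Relation.Unary.Unique.Propositional.Properties
  using (++⁺; filter⁺; downFrom⁺) renaming (map⁺ to Unique-map⁺)
open import Data.Nat as ℕ
  using (ℕ; zero; suc; _∸_; _!; _≤_; _<_; _%_; s≤s; z≤n; NonZero; >-nonZero; nonTrivial⇒≢1; nonTrivial⇒n>1)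
open import Data.Nat.Coprimality using (Coprime; coprime⇒GCD≡1; prime⇒coprime) renaming (sym to coprime-sym)
open import Data.Nat.Divisibility using (divides; ∣1⇒≡1; ∣⇒≤; m%n≡0⇒n∣m) renaming (_∣_ to _ℕ∣_)
open import Data.Nat.DivMod using (%-remove-+ʳ; m<n⇒m%n≡m; m%n<n)
open import Data.Nat.GCD using (module GCD; module Bézout)
open import Data.Nat.ListAction using (sum; product)
open import Data.Nat.ListAction.Properties using (sum-++; sum-↭; product-++; product-↭)
open import Data.Nat.Primality using (Prime; prime⇒nonZero; prime⇒nonTrivial; euclidsLemma)
open import Data.Nat.Properties
  using (+-comm; +-suc; +-identityʳ; +-cancelˡ-≡; *-identityˡ; *-identityʳ; suc-injective;
         ≤-refl; ≤-trans; ≤-total; ≤-pred; <-trans; <-cmp; <⇒≱; n≤1+n; n<1+n; n≢0⇒n>0;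
         m∸n≤m; ∸-cancelˡ-≡; m+[n∸m]≡n)
open import Data.Nat.Tactic.RingSolver using () renaming (solve-∀ to ℕ-solve-∀)
open import Data.Product using (∃; _×_; _,_; proj₁; proj₂)
open import Data.Sum as Sum using (_⊎_; inj₁; inj₂; [_,_]′)
open import Function.Base using (_∘_; id)
open import Function.Bundles using (mk⇔)
open import Level using (0ℓ)
open import Relation.Binary.Bundles using (Setoid)
open import Relation.Binary.Definitions using (DecidableEquality; tri<; tri≈; tri>)
open import Relation.Binary.PropositionalEquality
  using (_≡_; _≢_; refl; sym; trans; cong; cong₂; subst; module ≡-Reasoning)
import Relation.Binary.Reasoning.Setoid as ≈-Reasoning
open import Relation.Nullary using (¬_; yes; no; contradiction)

open import Defs

module _ {a} {A : Set a} (_≟_ : DecidableEquality A) where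

  open import Data.List.Membership.DecPropositional _≟_ using (_∈?_; _∉?_)

  ++-complement-↭ : ∀ {xs ys} → Unique xs → Unique ys → xs ⊆ ys →
                    xs ++ filter (_∉? xs) ys ↭ ys
  ++-complement-↭ {xs} {ys} xs! ys! xs⊆ys =
    ∼bag⇒↭ (unique∧set⇒bag (++⁺ xs! (filter⁺ (_∉? xs) {ys} ys!) disjoint) ys! (mk⇔ to from))
    where
    disjoint : ∀ {z} → z ∈ xs × z ∈ filter (_∉? xs) ys → ⊥
    disjoint (z∈xs , z∈rest) with ∈-filter⁻ (_∉? xs) {xs = ys} z∈rest
    ... | _ , z∉xs = z∉xs z∈xs
    to : ∀ {z} → z ∈ xs ++ filter (_∉? xs) ys → z ∈ ys
    to z∈ with ∈-++⁻ xs z∈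
    ... | inj₁ z∈xs   = xs⊆ys z∈xs
    ... | inj₂ z∈rest = proj₁ (∈-filter⁻ (_∉? xs) {xs = ys} z∈rest)
    from : ∀ {z} → z ∈ ys → z ∈ xs ++ filter (_∉? xs) ys
    from {z} z∈ys with z ∈? xs
    ... | yes z∈xs = ∈-++⁺ˡ z∈xs
    ... | no  z∉xs = ∈-++⁺ʳ xs (∈-filter⁺ (_∉? xs) z∈ys z∉xs)

  length-complement : ∀ {xs ys} → Unique xs → Unique ys → xs ⊆ ys →
                      length xs ℕ.+ length (filter (_∉? xs) ys) ≡ length ys
  length-complement {xs} xs! ys! xs⊆ys =
    trans (sym (length-++ xs)) (↭-length (++-complement-↭ xs! ys! xs⊆ys))

  ⊆-length-↭ : ∀ {xs ys} → Unique xs → Unique ys → xs ⊆ ys →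
               length xs ≡ length ys → xs ↭ ys
  ⊆-length-↭ {xs} {ys} xs! ys! xs⊆ys len
    with filter (_∉? xs) ys | ++-complement-↭ xs! ys! xs⊆ys | rest≡0
    where
    rest≡0 : length (filter (_∉? xs) ys) ≡ 0
    rest≡0 = +-cancelˡ-≡ (length xs) _ _
      (trans (length-complement xs! ys! xs⊆ys) (trans (sym len) (sym (+-identityʳ _))))
  ... | [] | xs++[]↭ys | _ = subst (_↭ ys) (++-identityʳ xs) xs++[]↭ys

  ⊆-missing-one : ∀ {xs ys} → Unique xs → Unique ys → xs ⊆ ys →
                  suc (length xs) ≡ length ys → ∃ λ x → x ∉ xs × xs ++ [ x ] ↭ ys
  ⊆-missing-one {xs} {ys} xs! ys! xs⊆ys len
    with filter (_∉? xs) ys | all-filter (_∉? xs) ys | ++-complement-↭ xs! ys! xs⊆ys | rest≡1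
    where
    rest≡1 : length (filter (_∉? xs) ys) ≡ 1
    rest≡1 = +-cancelˡ-≡ (length xs) _ _
      (trans (length-complement xs! ys! xs⊆ys) (trans (sym len) (+-comm 1 (length xs))))
  ... | x ∷ [] | x∉xs ∷ [] | xs++[x]↭ys | _ = x , x∉xs , xs++[x]↭ys

map-unique : ∀ {a b} {A : Set a} {B : Set b} {f : A → B} {xs} →
             (∀ {x y} → x ∈ xs → y ∈ xs → f x ≡ f y → x ≡ y) → Unique xs → Unique (map f xs)
map-unique inj [] = []
map-unique inj (x≢xs ∷ xs!) =
  All-map⁺ (All.tabulate λ y∈ fx≡fy → All.lookup x≢xs y∈ (inj (here refl) (there y∈) fx≡fy))
  ∷ map-unique (λ x∈ y∈ → inj (there x∈) (there y∈)) xs!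

map-injective-↭ : ∀ {a} {A : Set a} → DecidableEquality A → ∀ {f : A → A} {xs} → Unique xs →
                  (∀ {x y} → x ∈ xs → y ∈ xs → f x ≡ f y → x ≡ y) →
                  (∀ {x} → x ∈ xs → f x ∈ xs) → map f xs ↭ xs
map-injective-↭ _≟_ {f} {xs} xs! inj closed =
  ⊆-length-↭ _≟_ (map-unique inj xs!) xs! image⊆xs (length-map f xs)
  where
  image⊆xs : map f xs ⊆ xs
  image⊆xs z∈ with ∈-map⁻ f z∈
  ... | _ , x∈xs , refl = closed x∈xs

applyDownFrom-unique : ∀ {f : ℕ → ℕ} → (∀ {i j} → f i ≡ f j → i ≡ j) → ∀ n → Unique (applyDownFrom f n)
applyDownFrom-unique {f} f-injective n = subst Unique (map-downFrom f n) (Unique-map⁺ f-injective (downFrom⁺ n))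

∈-applyDownFrom-suc⁺ : ∀ {a n} → 0 < a → a < suc n → a ∈ applyDownFrom suc n
∈-applyDownFrom-suc⁺ {suc a} _ (s≤s a<n) = ∈-applyDownFrom⁺ suc a<n

∈-applyDownFrom-suc⁻ : ∀ {a n} → a ∈ applyDownFrom suc n → 0 < a × a < suc n
∈-applyDownFrom-suc⁻ a∈ with ∈-applyDownFrom⁻ suc a∈
... | _ , i<n , refl = s≤s z≤n , s≤s i<n

applyDownFrom-peel₂ : ∀ {a} {A : Set a} (f : ℕ → A) m →
                      applyDownFrom f (suc (suc m)) ≡ applyDownFrom (f ∘ suc ∘ suc) m ++ f 1 ∷ f 0 ∷ []
applyDownFrom-peel₂ f zero    = refl
applyDownFrom-peel₂ f (suc m) = cong (f (suc (suc m)) ∷_) (applyDownFrom-peel₂ f m)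

downFrom-reflect-↭ : ∀ n → map (n ∸_) (downFrom (suc n)) ↭ downFrom (suc n)
downFrom-reflect-↭ n = map-injective-↭ ℕ._≟_ (downFrom⁺ (suc n)) reflect-injective reflect-∈
  where
  reflect-injective : ∀ {k l} → k ∈ downFrom (suc n) → l ∈ downFrom (suc n) → n ∸ k ≡ n ∸ l → k ≡ l
  reflect-injective k∈ l∈ = ∸-cancelˡ-≡ (≤-pred (∈-downFrom⁻ k∈)) (≤-pred (∈-downFrom⁻ l∈))
  reflect-∈ : ∀ {k} → k ∈ downFrom (suc n) → n ∸ k ∈ downFrom (suc n)
  reflect-∈ {k} _ = ∈-downFrom⁺ (s≤s (m∸n≤m n k))

product-map-* : ∀ (f g : ℕ → ℕ) xs →
                product (map (λ k → f k ℕ.* g k) xs) ≡ product (map f xs) ℕ.* product (map g xs)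
product-map-* f g []       = refl
product-map-* f g (x ∷ xs) =
  trans (cong (f x ℕ.* g x ℕ.*_) (product-map-* f g xs))
        (interchange (f x) (g x) (product (map f xs)) (product (map g xs)))
  where
  interchange : ∀ a b c d → (a ℕ.* b) ℕ.* (c ℕ.* d) ≡ (a ℕ.* c) ℕ.* (b ℕ.* d)
  interchange = ℕ-solve-∀

product-applyDownFrom-suc : ∀ n → product (applyDownFrom suc n) ≡ n !
product-applyDownFrom-suc zero    = refl
product-applyDownFrom-suc (suc n) = cong (suc n ℕ.*_) (product-applyDownFrom-suc n)

sum-applyDownFrom-suc : ∀ n → 2 ℕ.* sum (applyDownFrom suc n) ≡ n ℕ.* suc n
sum-applyDownFrom-suc zero    = refl
sum-applyDownFrom-suc (suc n) =
  trans (distrib (sum (applyDownFrom suc n)))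
        (trans (cong (λ s → 2 ℕ.* suc n ℕ.+ s) (sum-applyDownFrom-suc n)) (gauss n))
  where
  distrib : ∀ s → 2 ℕ.* (suc n ℕ.+ s) ≡ 2 ℕ.* suc n ℕ.+ 2 ℕ.* s
  distrib = ℕ-solve-∀
  gauss : ∀ n → 2 ℕ.* suc n ℕ.+ n ℕ.* suc n ≡ suc n ℕ.* suc (suc n)
  gauss = ℕ-solve-∀

leftFactorial≡sum : ∀ n → leftFactorial n ≡ sum (applyDownFrom _! n)
leftFactorial≡sum zero    = refl
leftFactorial≡sum (suc n) =
  trans (+-comm (leftFactorial n) (n !)) (cong (λ s → n ! ℕ.+ s) (leftFactorial≡sum n))

superfactorial : ℕ → ℕ
superfactorial n = product (applyDownFrom _! (suc n))

superfactorial-square : ∀ n → superfactorial n ℕ.* superfactorial n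
                              ≡ product (map (λ k → k ! ℕ.* (n ∸ k) !) (downFrom (suc n)))
superfactorial-square n = begin
  superfactorial n ℕ.* superfactorial n
    ≡⟨ cong₂ ℕ._*_ sf≡ sf≡ ⟩
  product (map _! ks) ℕ.* product (map _! ks)
    ≡⟨ cong (λ c → product (map _! ks) ℕ.* c) (product-↭ (map⁺ _! (downFrom-reflect-↭ n))) ⟨
  product (map _! ks) ℕ.* product (map _! (map (n ∸_) ks))
    ≡⟨ cong (λ xs → product (map _! ks) ℕ.* product xs) (map-∘ {g = _!} {f = n ∸_} ks) ⟨
  product (map _! ks) ℕ.* product (map (λ k → (n ∸ k) !) ks)
    ≡⟨ product-map-* _! (λ k → (n ∸ k) !) ks ⟨
  product (map (λ k → k ! ℕ.* (n ∸ k) !) ks)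
    ∎
  where
  open ≡-Reasoning
  ks : List ℕ
  ks = downFrom (suc n)
  sf≡ : superfactorial n ≡ product (map _! ks)
  sf≡ = cong product (sym (map-downFrom _! (suc n)))

infix 4 _≡_mod_
record _≡_mod_ (a b : ℤ) (n : ℕ) : Set where
  constructor congruent
  field divides-difference : + n Signed.∣ a - b
open _≡_mod_ public

module _ {n : ℕ} where

  congruent-via : ∀ {a b c} → a - b ≡ c → + n Signed.∣ c → a ≡ b mod n
  congruent-via a-b≡c n∣c = congruent (subst (+ n Signed.∣_) (sym a-b≡c) n∣c)

  mod-reflexive : ∀ {a b} → a ≡ b → a ≡ b mod n
  mod-reflexive {a} refl = congruent-via (self a (+ n)) (Signed.divides (+ 0) refl)
    where
    self : ∀ a n → a - a ≡ + 0 * n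
    self = solve-∀

  mod-refl : ∀ {a} → a ≡ a mod n
  mod-refl = mod-reflexive refl

  mod-sym : ∀ {a b} → a ≡ b mod n → b ≡ a mod n
  mod-sym {a} {b} (congruent n∣a-b) = congruent-via (swap a b) (∣m⇒∣-m n∣a-b)
    where
    swap : ∀ a b → b - a ≡ - (a - b)
    swap = solve-∀

  mod-trans : ∀ {a b c} → a ≡ b mod n → b ≡ c mod n → a ≡ c mod n
  mod-trans {a} {b} {c} (congruent n∣a-b) (congruent n∣b-c) =
    congruent-via (split a b c) (∣m∣n⇒∣m+n n∣a-b n∣b-c)
    where
    split : ∀ a b c → a - c ≡ (a - b) + (b - c)
    split = solve-∀

  +-cong-mod : ∀ {a b c d} → a ≡ b mod n → c ≡ d mod n → a + c ≡ b + d mod n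
  +-cong-mod {a} {b} {c} {d} (congruent n∣a-b) (congruent n∣c-d) =
    congruent-via (split a b c d) (∣m∣n⇒∣m+n n∣a-b n∣c-d)
    where
    split : ∀ a b c d → (a + c) - (b + d) ≡ (a - b) + (c - d)
    split = solve-∀

  *-cong-mod : ∀ {a b c d} → a ≡ b mod n → c ≡ d mod n → a * c ≡ b * d mod n
  *-cong-mod {a} {b} {c} {d} (congruent n∣a-b) (congruent n∣c-d) =
    congruent-via (split a b c d) (∣m∣n⇒∣m+n (∣n⇒∣m*n a n∣c-d) (∣m⇒∣m*n d n∣a-b))
    where
    split : ∀ a b c d → a * c - b * d ≡ a * (c - d) + (a - b) * d
    split = solve-∀

  neg-cong-mod : ∀ {a b} → a ≡ b mod n → - a ≡ - b mod n
  neg-cong-mod {a} {b} (congruent n∣a-b) = congruent-via (negate a b) (∣m⇒∣-m n∣a-b)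
    where
    negate : ∀ a b → - a - - b ≡ - (a - b)
    negate = solve-∀

  ≡-⇒square≡ : ∀ {a b} → a ≡ - b mod n → a * a ≡ b * b mod n
  ≡-⇒square≡ {a} {b} a≡-b = mod-trans (*-cong-mod a≡-b a≡-b) (mod-reflexive (neg*neg b))
    where
    neg*neg : ∀ b → - b * - b ≡ b * b
    neg*neg = solve-∀

  ∣⇒≡0mod : ∀ {a} → + n Signed.∣ a → a ≡ + 0 mod n
  ∣⇒≡0mod {a} = congruent-via (ℤ.+-identityʳ a)

  ≡0mod⇒∣ : ∀ {a} → a ≡ + 0 mod n → + n Signed.∣ a
  ≡0mod⇒∣ {a} (congruent n∣a-0) = subst (+ n Signed.∣_) (ℤ.+-identityʳ a) n∣a-0

  -≡0mod⇒≡ : ∀ {a b} → a - b ≡ + 0 mod n → a ≡ b mod n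
  -≡0mod⇒≡ {a} {b} (congruent n∣a-b-0) = congruent-via (sym (ℤ.+-identityʳ (a - b))) n∣a-b-0

  +-≡0mod⇒≡- : ∀ {a b} → a + b ≡ + 0 mod n → a ≡ - b mod n
  +-≡0mod⇒≡- {a} {b} (congruent n∣a+b-0) = congruent-via (shift a b) n∣a+b-0
    where
    shift : ∀ a b → a - - b ≡ a + b - + 0
    shift = solve-∀

  ℕ∣+⇒≡-mod : ∀ {a b} → n ℕ∣ a ℕ.+ b → + a ≡ - + b mod n
  ℕ∣+⇒≡-mod {a} {b} n∣a+b =
    +-≡0mod⇒≡- (subst (_≡ + 0 mod n) (ℤ.pos-+ a b) (∣⇒≡0mod (∣ᵤ⇒∣ n∣a+b)))

≡mod-setoid : ℕ → Setoid 0ℓ 0ℓ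
≡mod-setoid n = record
  { _≈_           = λ a b → a ≡ b mod n
  ; isEquivalence = record { refl = mod-refl ; sym = mod-sym ; trans = mod-trans }
  }

%ℕ-≡mod : ∀ a n .{{_ : NonZero n}} → + (a %ℕ n) ≡ a mod n
%ℕ-≡mod a n =
  congruent-via (trans (cong (λ b → + (a %ℕ n) - b) (a≡a%ℕn+[a/ℕn]*n a n))
                       (cancel (+ (a %ℕ n)) (a ℤ./ℕ n) (+ n)))
                (Signed.divides (- (a ℤ./ℕ n)) refl)
  where
  cancel : ∀ r q n → r - (r + q * n) ≡ - q * n
  cancel = solve-∀

≡mod⇒%≡ : ∀ {a b n} .{{_ : NonZero n}} → + a ≡ + b mod n → a % n ≡ b % n
≡mod⇒%≡ {a} {b} {n} a≡b =
  [ (λ a≤b → sym (ordered a≤b a≡b)) , (λ b≤a → ordered b≤a (mod-sym a≡b)) ]′ (≤-total a b)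
  where
  ordered : ∀ {a b} → a ≤ b → + a ≡ + b mod n → b % n ≡ a % n
  ordered {a} {b} a≤b (congruent n∣a-b) = begin
    b % n               ≡⟨ cong (_% n) (m+[n∸m]≡n a≤b) ⟨
    (a ℕ.+ (b ∸ a)) % n ≡⟨ %-remove-+ʳ a n∣b∸a ⟩
    a % n               ∎
    where
    open ≡-Reasoning
    n∣b∸a : n ℕ∣ b ∸ a
    n∣b∸a = subst (n ℕ∣_) (trans (cong ℤ.∣_∣ (ℤ.[+m]-[+n]≡m⊖n a b)) (ℤ.∣⊖∣-≤ a≤b)) (∣⇒∣ᵤ n∣a-b)

%≡⇒≡mod : ∀ {a b n} .{{_ : NonZero n}} → a % n ≡ b % n → + a ≡ + b mod n
%≡⇒≡mod {a} {b} {n} a%n≡b%n =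
  mod-trans (mod-sym (%ℕ-≡mod (+ a) n)) (mod-trans (mod-reflexive (cong +_ a%n≡b%n)) (%ℕ-≡mod (+ b) n))

≡mod-<⇒≡ : ∀ {a b n} .{{_ : NonZero n}} → a < n → b < n → + a ≡ + b mod n → a ≡ b
≡mod-<⇒≡ a<n b<n a≡b = trans (sym (m<n⇒m%n≡m a<n)) (trans (≡mod⇒%≡ a≡b) (m<n⇒m%n≡m b<n))

module _ {n : ℕ} where

  open ≈-Reasoning (≡mod-setoid n)

  product-≡mod : ∀ (f g : ℕ → ℕ) xs → (∀ {k} → k ∈ xs → + f k ≡ + g k mod n) →
                 + product (map f xs) ≡ + product (map g xs) mod n
  product-≡mod f g []       _   = mod-refl
  product-≡mod f g (x ∷ xs) f≡g = begin
    + (f x ℕ.* product (map f xs))  ≡⟨ ℤ.pos-* (f x) _ ⟩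
    + f x * + product (map f xs)    ≈⟨ *-cong-mod (f≡g (here refl)) (product-≡mod f g xs (f≡g ∘ there)) ⟩
    + g x * + product (map g xs)    ≡⟨ ℤ.pos-* (g x) _ ⟨
    + (g x ℕ.* product (map g xs))  ∎

  sum-≡mod : ∀ (f g : ℕ → ℕ) xs → (∀ {k} → k ∈ xs → + f k ≡ + g k mod n) →
             + sum (map f xs) ≡ + sum (map g xs) mod n
  sum-≡mod f g []       _   = mod-refl
  sum-≡mod f g (x ∷ xs) f≡g = begin
    + (f x ℕ.+ sum (map f xs))  ≡⟨ ℤ.pos-+ (f x) _ ⟩
    + f x + + sum (map f xs)    ≈⟨ +-cong-mod (f≡g (here refl)) (sum-≡mod f g xs (f≡g ∘ there)) ⟩
    + g x + + sum (map g xs)    ≡⟨ ℤ.pos-+ (g x) _ ⟨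
    + (g x ℕ.+ sum (map g xs))  ∎

  product-≡1mod : ∀ (f : ℕ → ℕ) xs → (∀ {k} → k ∈ xs → + f k ≡ + 1 mod n) →
                  + product (map f xs) ≡ + 1 mod n
  product-≡1mod f xs f≡1 = mod-trans (product-≡mod f (λ _ → 1) xs f≡1) (mod-reflexive (product-ones xs))
    where
    product-ones : ∀ xs → + product (map (λ _ → 1) xs) ≡ + 1
    product-ones []       = refl
    product-ones (_ ∷ xs) = trans (cong +_ (+-identityʳ _)) (product-ones xs)

pos-1+* : ∀ b c → + (1 ℕ.+ b ℕ.* c) ≡ + 1 + + b * + c
pos-1+* b c = trans (ℤ.pos-+ 1 (b ℕ.* c)) (cong (λ c → + 1 + c) (ℤ.pos-* b c))

bézoutCoefficient : ℕ → ℕ → ℤ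
bézoutCoefficient a n with Bézout.lemma a n
... | Bézout.result _ _ (Bézout.+- x _ _) = + x
... | Bézout.result _ _ (Bézout.-+ x _ _) = - + x

bézoutCoefficient-spec : ∀ {a n} → Coprime a n → + a * bézoutCoefficient a n ≡ + 1 mod n
bézoutCoefficient-spec {a} {n} coprime with Bézout.lemma a n
... | Bézout.result _ gcd _ with GCD.unique gcd (coprime⇒GCD≡1 coprime)
bézoutCoefficient-spec {a} {n} _ | Bézout.result _ _ (Bézout.+- x y eq) | refl =
  congruent-via (trans (cong (_- + 1) ax≡) (cancel (+ y * + n))) (Signed.divides (+ y) refl)
  where
  ax≡ : + a * + x ≡ + 1 + + y * + n
  ax≡ = trans (ℤ.*-comm (+ a) (+ x)) (trans (sym (ℤ.pos-* x a)) (trans (cong +_ (sym eq)) (pos-1+* y n)))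
  cancel : ∀ c → + 1 + c - + 1 ≡ c
  cancel = solve-∀
bézoutCoefficient-spec {a} {n} _ | Bézout.result _ _ (Bézout.-+ x y eq) | refl =
  congruent-via (trans (rearrange (+ a) (+ x)) (trans (cong -_ xa≡) (ℤ.neg-distribˡ-* (+ y) (+ n))))
                (Signed.divides (- + y) refl)
  where
  xa≡ : + 1 + + x * + a ≡ + y * + n
  xa≡ = trans (sym (pos-1+* x a)) (trans (cong +_ eq) (ℤ.pos-* y n))
  rearrange : ∀ a x → a * - x - + 1 ≡ - (+ 1 + x * a)
  rearrange = solve-∀

module _ {p : ℕ} (prime : Prime p) where

  private instance
    p≢0 : NonZero p
    p≢0 = prime⇒nonZero prime

  *-≡0mod : ∀ {a b} → a * b ≡ + 0 mod p → a ≡ + 0 mod p ⊎ b ≡ + 0 mod p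
  *-≡0mod {a} {b} ab≡0 = Sum.map (∣⇒≡0mod ∘ ∣ᵤ⇒∣) (∣⇒≡0mod ∘ ∣ᵤ⇒∣)
    (euclidsLemma ℤ.∣ a ∣ ℤ.∣ b ∣ prime (subst (p ℕ∣_) (ℤ.abs-* a b) (∣⇒∣ᵤ (≡0mod⇒∣ ab≡0))))

  square-≡-square : ∀ {a b} → a * a ≡ b * b mod p → a ≡ b mod p ⊎ a ≡ - b mod p
  square-≡-square {a} {b} (congruent p∣a²-b²) =
    Sum.map -≡0mod⇒≡ +-≡0mod⇒≡- (*-≡0mod (congruent-via (factor a b) p∣a²-b²))
    where
    factor : ∀ a b → (a - b) * (a + b) - + 0 ≡ a * a - b * b
    factor = solve-∀

  prime∤! : ∀ {k} → k < p → ¬ p ℕ∣ k !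
  prime∤! {zero}  _   p∣1  = nonTrivial⇒≢1 {{prime⇒nonTrivial prime}} (∣1⇒≡1 p∣1)
  prime∤! {suc k} k<p p∣k! = [ (λ p∣1+k → <⇒≱ k<p (∣⇒≤ p∣1+k)) , prime∤! (<-trans (n<1+n k) k<p) ]′
                               (euclidsLemma (suc k) (k !) prime p∣k!)

  inverse : ℕ → ℕ
  inverse a = bézoutCoefficient a p %ℕ p

  inverse<p : ∀ a → inverse a < p
  inverse<p a = n%ℕd<d (bézoutCoefficient a p) p

  inverse-spec : ∀ {a} → 0 < a → a < p → + a * + inverse a ≡ + 1 mod p
  inverse-spec {a} 0<a a<p = begin
    + a * + inverse a            ≈⟨ *-cong-mod (mod-refl {a = + a}) (%ℕ-≡mod (bézoutCoefficient a p) p) ⟩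
    + a * bézoutCoefficient a p  ≈⟨ bézoutCoefficient-spec a-coprime-p ⟩
    + 1                          ∎
    where
    open ≈-Reasoning (≡mod-setoid p)
    a-coprime-p : Coprime a p
    a-coprime-p = coprime-sym (prime⇒coprime prime {{>-nonZero 0<a}} a<p)

module _ {n : ℕ} (prime : Prime (suc n)) where

  private
    units : List ℕ
    units = applyDownFrom suc n

  0≢1mod : ¬ (+ 0 ≡ + 1 mod suc n)
  0≢1mod 0≡1 with ≡mod-<⇒≡ (s≤s z≤n) (nonTrivial⇒n>1 (suc n) {{prime⇒nonTrivial prime}}) 0≡1
  ... | ()

  unit-inverse : ∀ {a} → a ∈ units → + a * + inverse prime a ≡ + 1 mod suc n
  unit-inverse a∈ = inverse-spec prime (proj₁ (∈-applyDownFrom-suc⁻ a∈)) (proj₂ (∈-applyDownFrom-suc⁻ a∈))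

  inverse-injective : ∀ {a b} → a ∈ units → b ∈ units → inverse prime a ≡ inverse prime b → a ≡ b
  inverse-injective {a} {b} a∈ b∈ a⁻¹≡b⁻¹ =
    ≡mod-<⇒≡ (proj₂ (∈-applyDownFrom-suc⁻ a∈)) (proj₂ (∈-applyDownFrom-suc⁻ b∈)) (begin
      + a                              ≡⟨ ℤ.*-identityʳ (+ a) ⟨
      + a * + 1                        ≈⟨ *-cong-mod (mod-refl {a = + a}) (mod-sym (unit-inverse b∈)) ⟩
      + a * (+ b * + inverse prime b)  ≡⟨ cong (λ c → + a * (+ b * + c)) a⁻¹≡b⁻¹ ⟨
      + a * (+ b * + inverse prime a)  ≡⟨ swap (+ a) (+ b) (+ inverse prime a) ⟩
      + b * (+ a * + inverse prime a)  ≈⟨ *-cong-mod (mod-refl {a = + b}) (unit-inverse a∈) ⟩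
      + b * + 1                        ≡⟨ ℤ.*-identityʳ (+ b) ⟩
      + b                              ∎)
    where
    open ≈-Reasoning (≡mod-setoid (suc n))
    swap : ∀ a b c → a * (b * c) ≡ b * (a * c)
    swap = solve-∀

  inverse-∈ : ∀ {a} → a ∈ units → inverse prime a ∈ units
  inverse-∈ {a} a∈ = ∈-applyDownFrom-suc⁺ (n≢0⇒n>0 a⁻¹≢0) (inverse<p prime a)
    where
    a⁻¹≢0 : inverse prime a ≢ 0
    a⁻¹≢0 a⁻¹≡0 = 0≢1mod (mod-trans (mod-reflexive (sym (ℤ.*-zeroʳ (+ a))))
      (subst (λ c → + a * + c ≡ + 1 mod suc n) a⁻¹≡0 (unit-inverse a∈)))

  factorial-square≡1 : + (n !) * + (n !) ≡ + 1 mod suc n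
  factorial-square≡1 = begin
    + (n !) * + (n !)                                    ≡⟨ ℤ.pos-* (n !) (n !) ⟨
    + (n ! ℕ.* n !)                                      ≡⟨ cong +_ pairing ⟨
    + product (map (λ a → a ℕ.* inverse prime a) units)  ≈⟨ product-≡1mod _ units a*a⁻¹≡1 ⟩
    + 1                                                  ∎
    where
    open ≈-Reasoning (≡mod-setoid (suc n))
    n!≡ : product units ≡ n !
    n!≡ = product-applyDownFrom-suc n
    inverse-permutes : map (inverse prime) units ↭ units
    inverse-permutes = map-injective-↭ ℕ._≟_ (applyDownFrom-unique suc-injective n) inverse-injective inverse-∈
    pairing : product (map (λ a → a ℕ.* inverse prime a) units) ≡ n ! ℕ.* n !
    pairing = trans (product-map-* id (inverse prime) units)
                    (cong₂ ℕ._*_ (trans (cong product (map-id units)) n!≡)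
                                 (trans (product-↭ inverse-permutes) n!≡))
    a*a⁻¹≡1 : ∀ {a} → a ∈ units → + (a ℕ.* inverse prime a) ≡ + 1 mod suc n
    a*a⁻¹≡1 {a} a∈ = mod-trans (mod-reflexive (ℤ.pos-* a _)) (unit-inverse a∈)

  complementary-factorials-square≡1 : ∀ i j → i ℕ.+ j ≡ n →
                                      + (i ! ℕ.* j !) * + (i ! ℕ.* j !) ≡ + 1 mod suc n
  complementary-factorials-square≡1 zero    j refl =
    mod-trans (mod-reflexive (cong (λ c → + c * + c) (*-identityˡ (j !)))) factorial-square≡1
  complementary-factorials-square≡1 (suc i) j 1+i+j≡n = begin
    + (suc i ! ℕ.* j !) * + (suc i ! ℕ.* j !)  ≈⟨ ≡-⇒square≡ sign-flip ⟩
    + (i ! ℕ.* suc j !) * + (i ! ℕ.* suc j !)  ≈⟨ complementary-factorials-square≡1 i (suc j) i+1+j≡n ⟩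
    + 1                                        ∎
    where
    open ≈-Reasoning (≡mod-setoid (suc n))
    i+1+j≡n : i ℕ.+ suc j ≡ n
    i+1+j≡n = trans (+-suc i j) 1+i+j≡n
    factor : ∀ i j a b → suc i ℕ.* a ℕ.* b ℕ.+ a ℕ.* (suc j ℕ.* b) ≡ a ℕ.* b ℕ.* suc (i ℕ.+ suc j)
    factor = ℕ-solve-∀
    sum≡ : suc i ! ℕ.* j ! ℕ.+ i ! ℕ.* suc j ! ≡ (i ! ℕ.* j !) ℕ.* suc n
    sum≡ = trans (factor i j (i !) (j !)) (cong (λ c → i ! ℕ.* j ! ℕ.* suc c) i+1+j≡n)
    sign-flip : + (suc i ! ℕ.* j !) ≡ - + (i ! ℕ.* suc j !) mod suc n
    sign-flip = ℕ∣+⇒≡-mod (divides (i ! ℕ.* j !) sum≡)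

  superfactorial-square≡±1 : + (superfactorial n ℕ.* superfactorial n) ≡ + 1 mod suc n
                           ⊎ + (superfactorial n ℕ.* superfactorial n) ≡ - + 1 mod suc n
  superfactorial-square≡±1 = square-≡-square prime (begin
    + sf² * + sf²                                 ≡⟨ ℤ.pos-* sf² sf² ⟨
    + (sf² ℕ.* sf²)                               ≡⟨ cong (λ c → + (c ℕ.* c)) (superfactorial-square n) ⟩
    + (product (map D ks) ℕ.* product (map D ks))  ≡⟨ cong +_ (product-map-* D D ks) ⟨
    + product (map (λ k → D k ℕ.* D k) ks)        ≈⟨ product-≡1mod _ ks D²≡1 ⟩
    + 1                                           ∎)
    where
    open ≈-Reasoning (≡mod-setoid (suc n))
    ks : List ℕ
    ks = downFrom (suc n)
    D : ℕ → ℕ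
    D k = k ! ℕ.* (n ∸ k) !
    sf² : ℕ
    sf² = superfactorial n ℕ.* superfactorial n
    D²≡1 : ∀ {k} → k ∈ ks → + (D k ℕ.* D k) ≡ + 1 mod suc n
    D²≡1 {k} k∈ = mod-trans (mod-reflexive (ℤ.pos-* (D k) (D k)))
      (complementary-factorials-square≡1 k (n ∸ k) (m+[n∸m]≡n (≤-pred (∈-downFrom⁻ k∈))))

  ∣sum-applyDownFrom-suc : 2 < suc n → suc n ℕ∣ sum (applyDownFrom suc n)
  ∣sum-applyDownFrom-suc 2<p = [ (λ p∣2 → contradiction (∣⇒≤ p∣2) (<⇒≱ 2<p)) , id ]′
    (euclidsLemma 2 _ prime (divides n (sum-applyDownFrom-suc n)))

suc-factorial≡-factorial : ∀ m → + (suc m !) ≡ - + (m !) mod suc (suc m)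
suc-factorial≡-factorial m = ℕ∣+⇒≡-mod (divides (m !) (factor m (m !)))
  where
  factor : ∀ m a → suc m ℕ.* a ℕ.+ a ≡ a ℕ.* suc (suc m)
  factor = ℕ-solve-∀

module LeftFactorialSquare
  {m : ℕ} (prime : Prime (suc (suc m))) (2≤m : 2 ≤ m)
  (distinct : ∀ i j → 2 ≤ i → i < j → j ≤ suc m → ¬ (+ suc (suc m) ∣ + (i !) - + (j !)))
  where

  private
    p : ℕ
    p = suc (suc m)

    -- units = [p-1, …, 1] and ks = [p-1, …, 2]
    units : List ℕ
    units = applyDownFrom suc (suc m)

    ks : List ℕ
    ks = applyDownFrom (suc ∘ suc) m

    residue : ℕ → ℕ
    residue k = k ! % p

    residues : List ℕ
    residues = map residue ks

  factorial≡residue : ∀ k → + (k !) ≡ + residue k mod p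
  factorial≡residue k = mod-sym (%ℕ-≡mod (+ (k !)) p)

  ∈-ks⁺ : ∀ {k} → 2 ≤ k → k ≤ suc m → k ∈ ks
  ∈-ks⁺ {suc (suc i)} (s≤s (s≤s z≤n)) (s≤s i<m) = ∈-applyDownFrom⁺ (suc ∘ suc) i<m

  ∈-ks⁻ : ∀ {k} → k ∈ ks → 2 ≤ k × k ≤ suc m
  ∈-ks⁻ k∈ with ∈-applyDownFrom⁻ (suc ∘ suc) k∈
  ... | _ , i<m , refl = s≤s (s≤s z≤n) , s≤s i<m

  residue-injective : ∀ {k l} → k ∈ ks → l ∈ ks → residue k ≡ residue l → k ≡ l
  residue-injective {k} {l} k∈ l∈ r≡ with <-cmp k l
  ... | tri< k<l _ _ = contradiction (∣⇒∣ᵤ (divides-difference (%≡⇒≡mod {k !} {l !} r≡)))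
                                     (distinct k l (proj₁ (∈-ks⁻ k∈)) k<l (proj₂ (∈-ks⁻ l∈)))
  ... | tri≈ _ k≡l _ = k≡l
  ... | tri> _ _ l<k = contradiction (∣⇒∣ᵤ (divides-difference (%≡⇒≡mod {l !} {k !} (sym r≡))))
                                     (distinct l k (proj₁ (∈-ks⁻ l∈)) l<k (proj₂ (∈-ks⁻ k∈)))

  residue-∈ : ∀ {k} → k ∈ ks → residue k ∈ units
  residue-∈ {k} k∈ = ∈-applyDownFrom-suc⁺ (n≢0⇒n>0 r≢0) (m%n<n (k !) p)
    where
    r≢0 : residue k ≢ 0
    r≢0 r≡0 = prime∤! prime (s≤s (proj₂ (∈-ks⁻ k∈))) (m%n≡0⇒n∣m (k !) p r≡0)

  missing : ∃ λ x → x ∉ residues × residues ++ [ x ] ↭ units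
  missing = ⊆-missing-one ℕ._≟_
    (map-unique residue-injective (applyDownFrom-unique (suc-injective ∘ suc-injective) m))
    (applyDownFrom-unique suc-injective (suc m))
    residues⊆units
    (cong suc (trans (length-map residue ks) (trans (length-applyDownFrom (suc ∘ suc) m)
                                                    (sym (length-applyDownFrom suc m)))))
    where
    residues⊆units : residues ⊆ units
    residues⊆units r∈ with ∈-map⁻ residue r∈
    ... | _ , k∈ , refl = residue-∈ k∈

  private
    x : ℕ
    x = proj₁ missing

    x∉residues : x ∉ residues
    x∉residues = proj₁ (proj₂ missing)

    residues+x↭units : residues ++ [ x ] ↭ units
    residues+x↭units = proj₂ (proj₂ missing)

  x<p : x < p
  x<p = proj₂ (∈-applyDownFrom-suc⁻ (∈-resp-↭ residues+x↭units (∈-++⁺ʳ residues (here refl))))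

  x≢factorial : ∀ {k} → 2 ≤ k → k ≤ suc m → ¬ (+ x ≡ + (k !) mod p)
  x≢factorial {k} 2≤k k≤1+m x≡k! =
    x∉residues (subst (_∈ residues) r≡x (∈-map⁺ residue (∈-ks⁺ 2≤k k≤1+m)))
    where
    r≡x : residue k ≡ x
    r≡x = trans (sym (≡mod⇒%≡ {x} {k !} x≡k!)) (m<n⇒m%n≡m x<p)

  factorials-split : applyDownFrom _! p ≡ map _! ks ++ 1 ∷ 1 ∷ []
  factorials-split =
    trans (applyDownFrom-peel₂ _! m) (cong (_++ 1 ∷ 1 ∷ []) (sym (map-applyDownFrom (suc ∘ suc) _! m)))

  leftFactorial-2≡-x : + leftFactorial p - + 2 ≡ - + x mod p
  leftFactorial-2≡-x = begin
    + leftFactorial p - + 2          ≡⟨ cong (λ c → + c - + 2) lf≡ ⟩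
    + (sum (map _! ks) ℕ.+ 2) - + 2  ≡⟨ cong (_- + 2) (ℤ.pos-+ (sum (map _! ks)) 2) ⟩
    + sum (map _! ks) + + 2 - + 2    ≡⟨ cancel (+ sum (map _! ks)) ⟩
    + sum (map _! ks)                ≈⟨ sum-≡mod _! residue ks (λ {k} _ → factorial≡residue k) ⟩
    + sum residues                   ≈⟨ ℕ∣+⇒≡-mod p∣sum ⟩
    - + x                            ∎
    where
    open ≈-Reasoning (≡mod-setoid p)
    lf≡ : leftFactorial p ≡ sum (map _! ks) ℕ.+ 2
    lf≡ = trans (leftFactorial≡sum p) (trans (cong sum factorials-split) (sum-++ (map _! ks) (1 ∷ 1 ∷ [])))
    sum≡ : sum residues ℕ.+ x ≡ sum units
    sum≡ = trans (cong (λ c → sum residues ℕ.+ c) (sym (+-identityʳ x)))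
                 (trans (sym (sum-++ residues [ x ])) (sum-↭ residues+x↭units))
    2<p : 2 < p
    2<p = s≤s (s≤s (≤-trans (s≤s z≤n) 2≤m))
    p∣sum : p ℕ∣ sum residues ℕ.+ x
    p∣sum = subst (p ℕ∣_) (sym sum≡) (∣sum-applyDownFrom-suc prime 2<p)
    cancel : ∀ s → s + + 2 - + 2 ≡ s
    cancel = solve-∀

  superfactorial*x≡factorial : + superfactorial (suc m) * + x ≡ + (suc m !) mod p
  superfactorial*x≡factorial = begin
    + superfactorial (suc m) * + x  ≡⟨ cong (λ c → + c * + x) sf≡ ⟩
    + product (map _! ks) * + x     ≈⟨ *-cong-mod (product-≡mod _! residue ks (λ {k} _ → factorial≡residue k)) mod-refl ⟩
    + product residues * + x        ≡⟨ ℤ.pos-* (product residues) x ⟨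
    + (product residues ℕ.* x)      ≡⟨ cong +_ product≡ ⟩
    + (suc m !)                     ∎
    where
    open ≈-Reasoning (≡mod-setoid p)
    sf≡ : superfactorial (suc m) ≡ product (map _! ks)
    sf≡ = trans (cong product factorials-split)
                (trans (product-++ (map _! ks) (1 ∷ 1 ∷ [])) (*-identityʳ (product (map _! ks))))
    product≡ : product residues ℕ.* x ≡ suc m !
    product≡ = trans (cong (λ c → product residues ℕ.* c) (sym (*-identityʳ x)))
               (trans (sym (product-++ residues [ x ]))
               (trans (product-↭ residues+x↭units) (product-applyDownFrom-suc (suc m))))

  x²≡-1 : + x * + x ≡ - + 1 mod p
  x²≡-1 = [ (λ S≡1 → contradiction S≡1 S≢1) , S≡-1⇒x²≡-1 ]′ (superfactorial-square≡±1 prime)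
    where
    open ≈-Reasoning (≡mod-setoid p)
    sf W : ℕ
    sf = superfactorial (suc m)
    W  = suc m !
    S*x²≡1 : + (sf ℕ.* sf) * (+ x * + x) ≡ + 1 mod p
    S*x²≡1 = begin
      + (sf ℕ.* sf) * (+ x * + x)  ≡⟨ cong (_* (+ x * + x)) (ℤ.pos-* sf sf) ⟩
      + sf * + sf * (+ x * + x)    ≡⟨ interchange (+ sf) (+ x) ⟩
      (+ sf * + x) * (+ sf * + x)  ≈⟨ *-cong-mod superfactorial*x≡factorial superfactorial*x≡factorial ⟩
      + W * + W                    ≈⟨ factorial-square≡1 prime ⟩
      + 1                          ∎
      where
      interchange : ∀ s x → s * s * (x * x) ≡ (s * x) * (s * x)
      interchange = solve-∀
    S≢1 : ¬ (+ (sf ℕ.* sf) ≡ + 1 mod p)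
    S≢1 S≡1 = contradiction (square-≡-square prime x²≡W²) x≢±W
      where
      x²≡W² : + x * + x ≡ + W * + W mod p
      x²≡W² = begin
        + x * + x                    ≡⟨ ℤ.*-identityˡ (+ x * + x) ⟨
        + 1 * (+ x * + x)            ≈⟨ *-cong-mod (mod-sym S≡1) mod-refl ⟩
        + (sf ℕ.* sf) * (+ x * + x)  ≈⟨ S*x²≡1 ⟩
        + 1                          ≈⟨ factorial-square≡1 prime ⟨
        + W * + W                    ∎
      x≢±W : ¬ (+ x ≡ + W mod p ⊎ + x ≡ - + W mod p)
      x≢±W (inj₁ x≡W)  = x≢factorial (≤-trans 2≤m (n≤1+n m)) ≤-refl x≡W
      x≢±W (inj₂ x≡-W) = x≢factorial 2≤m (n≤1+n m)
        (mod-trans x≡-W (mod-trans (neg-cong-mod (suc-factorial≡-factorial m))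
                                   (mod-reflexive (ℤ.neg-involutive _))))
    S≡-1⇒x²≡-1 : + (sf ℕ.* sf) ≡ - + 1 mod p → + x * + x ≡ - + 1 mod p
    S≡-1⇒x²≡-1 S≡-1 = begin
      + x * + x                        ≡⟨ double-negation (+ x * + x) ⟩
      - (- + 1 * (+ x * + x))          ≈⟨ neg-cong-mod (*-cong-mod (mod-sym S≡-1) mod-refl) ⟩
      - (+ (sf ℕ.* sf) * (+ x * + x))  ≈⟨ neg-cong-mod S*x²≡1 ⟩
      - + 1                            ∎
      where
      double-negation : ∀ a → a ≡ - (- + 1 * a)
      double-negation = solve-∀

  leftFactorial-2-square≡-1 : (+ leftFactorial p - + 2) * (+ leftFactorial p - + 2) ≡ - + 1 mod p
  leftFactorial-2-square≡-1 = mod-trans (≡-⇒square≡ leftFactorial-2≡-x) x²≡-1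

mainTheorem1 : (p : ℕ) → Prime p → 5 < p →
    (∀ i j → 2 ≤ i → i < j → j ≤ p ∸ 1 → ¬ ((+ p) ∣ (+ (i !) - + (j !)))) →
    (+ p) ∣ ((+ leftFactorial p - + 2) * (+ leftFactorial p - + 2) + + 1)
mainTheorem1 (suc (suc m)) p-prime (s≤s (s≤s 4≤m)) distinct =
  ∣⇒∣ᵤ (≡0mod⇒∣ (+-cong-mod (leftFactorial-2-square≡-1 p-prime 2≤m distinct) mod-refl))
  where
  open LeftFactorialSquare using (leftFactorial-2-square≡-1)
  2≤m : 2 ≤ m
  2≤m = ≤-trans (s≤s (s≤s z≤n)) 4≤m
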